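{- Let $k\ge r\ge 1$ be integers. Let $\mathcal{P}_{k,r}$ be the set of partitions $(\pi_1,\dots,\pi_\ell)$ such that (1) for every $1\le i\le \ell$ there is an integer $\varphi_{k,r}(\pi_i)\in\{1,\dots,r\}$ with $\pi_i\equiv \varphi_{k,r}(\pi_i)\pmod k$, and (2) $\varphi_{k,r}(\pi_i)\ge \varphi_{k,r}(\pi_{i+1})$ for $1\le i<\ell$. Then \[\sum_{\pi\in\mathcal{P}_{k,r}} z^{\ell(\pi)}q^{|\pi|}=\sum_{m\ge 0}\frac{z^m q^m}{(q^k;q^k)_m}{{m+r-1}\brack{r-1}}_1 .\]
   Context: A partition $\pi=(\pi_1,\dots,\pi_\ell)$ is a finite non-increasing sequence of positive integers; $\ell(\pi)$ is its number of parts and $|\pi|$ the sum of its parts (the empty partition is allowed). Throughout $|q|<1$. $(a;q)_\infty=\prod_{i\ge0}(1-aq^i)$ and $(a;q)_n=(a;q)_\infty/(aq^n;q)_\infty$. For nonnegative integers $A,B$ and a positive integer $k$, ${A\brack B}_k=\frac{(q^k;q^k)_A}{(q^k;q^k)_B(q^k;q^k)_{A-B}}$ if $A\ge B\ge 0$ and $0$ otherwise. -}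

module Defs where

open import Data.Nat using (ℕ; zero; suc; _+_; _∸_; _≤_; _≥_; _≤ᵇ_; _≡ᵇ_)
open import Data.Integer as ℤ using (ℤ; +_; -_)
open import Data.Integer.Divisibility using () renaming (_∣_ to _∣ℤ_)
open import Data.List using (List; []; _∷_; length; upTo; zipWith; foldr)
open import Data.List.Relation.Unary.All using (All)
open import Data.List.Relation.Unary.Linked using (Linked)
open import Data.List.Relation.Binary.Pointwise using (Pointwise)
open import Data.Product using (Σ; _×_)
open import Data.Bool using (if_then_else_)

IsPartition : List ℕ → Set
IsPartition π = All (1 ≤_) π × Linked _≥_ π

HasPhi : ℕ → ℕ → ℕ → ℕ → Set
HasPhi k r x v = (1 ≤ v) × (v ≤ r) × ((+ k) ∣ℤ ((+ x) ℤ.- (+ v)))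

InP : ℕ → ℕ → List ℕ → Set
InP k r π = Σ (List ℕ) (λ φs → Pointwise (HasPhi k r) π φs × Linked _≥_ φs)

-- Formal power series in q with integer coefficients: n ↦ coeff of q^n.

PS : Set
PS = ℕ → ℤ

sumTo : ℕ → (ℕ → ℤ) → ℤ
sumTo zero    f = f zero
sumTo (suc n) f = sumTo n f ℤ.+ f (suc n)

_⋆_ : PS → PS → PS
(f ⋆ g) n = sumTo n (λ i → f i ℤ.* g (n ∸ i))

oneS : PS
oneS n = if n ≡ᵇ 0 then + 1 else + 0

oneMinusQ : ℕ → PS
oneMinusQ j n = (if n ≡ᵇ 0 then + 1 else + 0) ℤ.- (if n ≡ᵇ j then + 1 else + 0)

shift : ℕ → PS → PS
shift m f n = if m ≤ᵇ n then f (n ∸ m) else + 0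

-- Multiplicative inverse of a power series with constant term 1:
-- invRev f n = [c_n, …, c_1, c_0] where c_0 = 1 and
-- c_{n+1} = - Σ_{j=0}^{n} f(j+1) c_{n-j}.
invRev : PS → ℕ → List ℤ
invRev f zero    = + 1 ∷ []
invRev f (suc n) =
  (- sumL (zipWith (λ j c → f (suc j) ℤ.* c) (upTo (suc n)) (invRev f n)))
  ∷ invRev f n
  where
  sumL : List ℤ → ℤ
  sumL = foldr ℤ._+_ (+ 0)

inv : PS → PS
inv f n with invRev f n
... | []    = + 0
... | c ∷ _ = c

-- (q^k;q^k)_m = ∏_{i=0}^{m-1} (1 - q^{k + k i})
poch : ℕ → ℕ → PS
poch k zero    = oneS
poch k (suc m) = poch k m ⋆ oneMinusQ (k + k Data.Nat.* m)

qbinom : ℕ → ℕ → ℕ → PS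
qbinom A B k =
  if B ≤ᵇ A then (poch k A ⋆ inv (poch k B)) ⋆ inv (poch k (A ∸ B))
  else (λ _ → + 0)

-- Coefficient of z^m in the right-hand side:
-- q^m / (q^k;q^k)_m · [m+r-1 brack r-1]_1
rhsCoeff : ℕ → ℕ → ℕ → PS
rhsCoeff k r m = shift m (inv (poch k m) ⋆ qbinom (m + r ∸ 1) (r ∸ 1) 1)

{-# OPTIONS --safe #-}
module Submission where

-- Write each part as πᵢ = φᵢ + k aᵢ with φᵢ = φ_{k,r}(πᵢ) ∈ {1,…,r}. Because r ≤ k, the parts are
-- non-increasing and the φᵢ are non-increasing exactly when both (aᵢ) and (φᵢ) are non-increasing,
-- and the two sequences can be chosen independently. So the partitions of length m are counted by
-- q^m times the product of the generating functions of a₁ ≥ … ≥ aₘ ≥ 0 (weight q^(k Σ aᵢ)) and of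
-- r-1 ≥ φ₁-1 ≥ … ≥ φₘ-1 ≥ 0 (weight q^(Σ (φᵢ-1))). Under a bound a₁ ≤ A both are Gaussian
-- polynomials, by Pascal's recursion and [m+A, m]·(q;q)_m·(q;q)_A = (q;q)_{m+A}; the first one
-- agrees with 1/(q^k;q^k)_m up to degree A, and A = n is no restriction on partitions of n.

open import Defs
open import Data.Nat using (ℕ; _≤_)
open import Data.Integer using (+_)
open import Data.List using (List; length)
open import Data.Nat.ListAction using (sum)
open import Data.List.Relation.Unary.Unique.Propositional using (Unique)
open import Data.List.Membership.Propositional using (_∈_)
open import Data.Product using (Σ; _×_)
open import Function.Bundles using (_⇔_)
open import Relation.Binary.PropositionalEquality using (_≡_)

open import Data.Bool using (true; false; if_then_else_)
open import Data.Empty using (⊥-elim)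
open import Data.Integer as ℤ using (ℤ; -_)
import Data.Integer.Properties as ℤ
open import Algebra.Properties.CommutativeSemigroup ℤ.+-commutativeSemigroup
  using () renaming (interchange to +-interchange)
open import Data.Integer.Divisibility using () renaming (_∣_ to _∣ℤ_)
open import Data.Integer.Tactic.RingSolver using (solve-∀)
open import Data.List using ([]; _∷_; _++_; map; foldr; zipWith; applyUpTo; downFrom)
import Data.List.Properties as List
open import Data.List.Membership.Propositional.Properties
  using (∈-++⁻; ∈-++⁺ˡ; ∈-++⁺ʳ; ∈-map⁻; ∈-map⁺)
open import Data.List.Relation.Binary.Disjoint.Propositional using (Disjoint)
open import Data.List.Relation.Binary.Pointwise using (Pointwise; []; _∷_)
open import Data.List.Relation.Unary.All using (All; []; _∷_)
open import Data.List.Relation.Unary.AllPairs using ([]; _∷_)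
open import Data.List.Relation.Unary.Any using (here; there)
open import Data.List.Relation.Unary.Linked as Linked using (Linked; []; [-]; _∷_)
import Data.List.Relation.Unary.Unique.Propositional.Properties as Unique
open import Data.Nat as ℕ using (zero; suc; _+_; _*_; _∸_; _<_; _≥_; z≤n; s≤s; _≤ᵇ_; _≡ᵇ_)
import Data.Nat.Properties as ℕ
open import Data.Nat.Divisibility using (divides; >⇒∤)
import Data.Nat.Tactic.RingSolver as ℕ-Solver
open import Data.Product using (_,_; proj₁; proj₂)
open import Data.Sum using (inj₁; inj₂)
open import Function using (_∘_; id)
open import Function.Bundles using (mk⇔)
open import Relation.Nullary using (yes; no)
open import Level using (0ℓ)
open import Relation.Binary.Bundles using (Setoid)
open import Relation.Binary.PropositionalEquality
  using (_≢_; refl; sym; trans; cong; cong₂; subst; subst₂; module ≡-Reasoning)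
import Relation.Binary.Reasoning.Setoid as SetoidReasoning

sumTo-cong : ∀ n {f g : ℕ → ℤ} → (∀ i → i ≤ n → f i ≡ g i) → sumTo n f ≡ sumTo n g
sumTo-cong zero    f≗g = f≗g 0 z≤n
sumTo-cong (suc n) f≗g =
  cong₂ ℤ._+_ (sumTo-cong n (λ i i≤n → f≗g i (ℕ.m≤n⇒m≤1+n i≤n))) (f≗g (suc n) ℕ.≤-refl)

sumTo-zeros : ∀ n {f : ℕ → ℤ} → (∀ i → i ≤ n → f i ≡ + 0) → sumTo n f ≡ + 0
sumTo-zeros zero    f≗0 = f≗0 0 z≤n
sumTo-zeros (suc n) f≗0 =
  cong₂ ℤ._+_ (sumTo-zeros n (λ i i≤n → f≗0 i (ℕ.m≤n⇒m≤1+n i≤n))) (f≗0 (suc n) ℕ.≤-refl)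

sumTo-+ : ∀ n (f g : ℕ → ℤ) → sumTo n (λ i → f i ℤ.+ g i) ≡ sumTo n f ℤ.+ sumTo n g
sumTo-+ zero    f g = refl
sumTo-+ (suc n) f g = trans (cong (ℤ._+ (f (suc n) ℤ.+ g (suc n))) (sumTo-+ n f g))
  (+-interchange (sumTo n f) (sumTo n g) (f (suc n)) (g (suc n)))

sumTo-*ˡ : ∀ n c (f : ℕ → ℤ) → sumTo n (λ i → c ℤ.* f i) ≡ c ℤ.* sumTo n f
sumTo-*ˡ zero    c f = refl
sumTo-*ˡ (suc n) c f = trans (cong (ℤ._+ (c ℤ.* f (suc n))) (sumTo-*ˡ n c f))
  (sym (ℤ.*-distribˡ-+ c (sumTo n f) (f (suc n))))

sumTo-*ʳ : ∀ n c (f : ℕ → ℤ) → sumTo n (λ i → f i ℤ.* c) ≡ sumTo n f ℤ.* c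
sumTo-*ʳ zero    c f = refl
sumTo-*ʳ (suc n) c f = trans (cong (ℤ._+ (f (suc n) ℤ.* c)) (sumTo-*ʳ n c f))
  (sym (ℤ.*-distribʳ-+ c (sumTo n f) (f (suc n))))

sumTo-suc : ∀ n (f : ℕ → ℤ) → sumTo (suc n) f ≡ f 0 ℤ.+ sumTo n (f ∘ suc)
sumTo-suc zero    f = refl
sumTo-suc (suc n) f = trans (cong (ℤ._+ f (suc (suc n))) (sumTo-suc n f))
  (ℤ.+-assoc (f 0) (sumTo n (f ∘ suc)) (f (suc (suc n))))

sumTo-reverse : ∀ n (f : ℕ → ℤ) → sumTo n f ≡ sumTo n (λ i → f (n ∸ i))
sumTo-reverse zero    f = refl
sumTo-reverse (suc n) f = begin
  sumTo n f ℤ.+ f (suc n)                 ≡⟨ cong (ℤ._+ f (suc n)) (sumTo-reverse n f) ⟩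
  sumTo n (λ i → f (n ∸ i)) ℤ.+ f (suc n) ≡⟨ ℤ.+-comm _ (f (suc n)) ⟩
  f (suc n) ℤ.+ sumTo n (λ i → f (n ∸ i)) ≡⟨ sumTo-suc n (λ i → f (suc n ∸ i)) ⟨
  sumTo (suc n) (λ i → f (suc n ∸ i))     ∎
  where open ≡-Reasoning

sumTo-drop : ∀ x N (f : ℕ → ℤ) → (∀ i → i < x → f i ≡ + 0) →
             sumTo (x + N) f ≡ sumTo N (λ i → f (x + i))
sumTo-drop zero    N f f≗0 = refl
sumTo-drop (suc x) N f f≗0 = begin
  sumTo (suc (x + N)) f                   ≡⟨ sumTo-suc (x + N) f ⟩
  f 0 ℤ.+ sumTo (x + N) (f ∘ suc)         ≡⟨ cong₂ ℤ._+_ (f≗0 0 (s≤s z≤n))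
                                               (sumTo-drop x N (f ∘ suc) (λ i i<x → f≗0 (suc i) (s≤s i<x))) ⟩
  + 0 ℤ.+ sumTo N (λ i → f (suc (x + i))) ≡⟨ ℤ.+-identityˡ _ ⟩
  sumTo N (λ i → f (suc x + i))           ∎
  where open ≡-Reasoning

sumTo-triangle : ∀ n (F : ℕ → ℕ → ℤ) →
  sumTo n (λ i → sumTo i (F i)) ≡ sumTo n (λ j → sumTo (n ∸ j) (λ l → F (j + l) j))
sumTo-triangle zero    F = refl
sumTo-triangle (suc n) F = begin
  sumTo n (λ i → sumTo i (F i)) ℤ.+ sumTo (suc n) (F (suc n))
    ≡⟨ cong (ℤ._+ sumTo (suc n) (F (suc n))) (sumTo-triangle n F) ⟩
  sumTo n (λ j → sumTo (n ∸ j) (column j)) ℤ.+ (sumTo n (F (suc n)) ℤ.+ F (suc n) (suc n))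
    ≡⟨ ℤ.+-assoc (sumTo n (λ j → sumTo (n ∸ j) (column j))) (sumTo n (F (suc n))) _ ⟨
  sumTo n (λ j → sumTo (n ∸ j) (column j)) ℤ.+ sumTo n (F (suc n)) ℤ.+ F (suc n) (suc n)
    ≡⟨ cong (ℤ._+ F (suc n) (suc n)) (sumTo-+ n _ _) ⟨
  sumTo n (λ j → sumTo (n ∸ j) (column j) ℤ.+ F (suc n) j) ℤ.+ F (suc n) (suc n)
    ≡⟨ cong₂ ℤ._+_ (sumTo-cong n extend-column) last-column ⟩
  sumTo n (λ j → sumTo (suc n ∸ j) (column j)) ℤ.+ sumTo (suc n ∸ suc n) (column (suc n)) ∎
  where
  open ≡-Reasoning
  column : ℕ → ℕ → ℤ
  column j l = F (j + l) j
  extend-column : ∀ j → j ≤ n → sumTo (n ∸ j) (column j) ℤ.+ F (suc n) j ≡ sumTo (suc n ∸ j) (column j)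
  extend-column j j≤n = begin
    sumTo (n ∸ j) (column j) ℤ.+ F (suc n) j
      ≡⟨ cong (λ x → sumTo (n ∸ j) (column j) ℤ.+ F x j)
              (sym (trans (ℕ.+-suc j (n ∸ j)) (cong suc (ℕ.m+[n∸m]≡n j≤n)))) ⟩
    sumTo (suc (n ∸ j)) (column j)
      ≡⟨ cong (λ x → sumTo x (column j)) (ℕ.+-∸-assoc 1 j≤n) ⟨
    sumTo (suc n ∸ j) (column j) ∎
  last-column : F (suc n) (suc n) ≡ sumTo (n ∸ n) (column (suc n))
  last-column rewrite ℕ.n∸n≡0 n | ℕ.+-identityʳ n = refl

-- Formal power series

infix  4 _≈_
infixl 6 _⊕_

_≈_ : PS → PS → Set
f ≈ g = ∀ n → f n ≡ g n

≈-setoid : Setoid 0ℓ 0ℓ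
≈-setoid = record
  { Carrier       = PS
  ; _≈_           = _≈_
  ; isEquivalence = record
    { refl  = λ _ → refl
    ; sym   = λ f≈g n → sym (f≈g n)
    ; trans = λ f≈g g≈h n → trans (f≈g n) (g≈h n)
    }
  }

open Setoid ≈-setoid using () renaming (refl to ≈-refl; sym to ≈-sym; trans to ≈-trans)

_⊕_ : PS → PS → PS
(f ⊕ g) n = f n ℤ.+ g n

⊕-cong : ∀ {f f′ g g′} → f ≈ f′ → g ≈ g′ → f ⊕ g ≈ f′ ⊕ g′
⊕-cong f≈f′ g≈g′ n = cong₂ ℤ._+_ (f≈f′ n) (g≈g′ n)

⋆-cong : ∀ {f f′ g g′} → f ≈ f′ → g ≈ g′ → f ⋆ g ≈ f′ ⋆ g′
⋆-cong f≈f′ g≈g′ n = sumTo-cong n (λ i _ → cong₂ ℤ._*_ (f≈f′ i) (g≈g′ (n ∸ i)))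

⋆-congˡ : ∀ f {g g′} → g ≈ g′ → f ⋆ g ≈ f ⋆ g′
⋆-congˡ f = ⋆-cong {f} ≈-refl

⋆-congʳ : ∀ h {f g} → f ≈ g → f ⋆ h ≈ g ⋆ h
⋆-congʳ h f≈g = ⋆-cong f≈g (≈-refl {h})

⋆-comm : ∀ f g → f ⋆ g ≈ g ⋆ f
⋆-comm f g n = begin
  sumTo n (λ i → f i ℤ.* g (n ∸ i))             ≡⟨ sumTo-reverse n _ ⟩
  sumTo n (λ i → f (n ∸ i) ℤ.* g (n ∸ (n ∸ i))) ≡⟨ sumTo-cong n swap ⟩
  sumTo n (λ i → g i ℤ.* f (n ∸ i))             ∎
  where
  open ≡-Reasoning
  swap : ∀ i → i ≤ n → f (n ∸ i) ℤ.* g (n ∸ (n ∸ i)) ≡ g i ℤ.* f (n ∸ i)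
  swap i i≤n = trans (cong (λ j → f (n ∸ i) ℤ.* g j) (ℕ.m∸[m∸n]≡n i≤n)) (ℤ.*-comm (f (n ∸ i)) (g i))

⋆-assoc : ∀ f g h → (f ⋆ g) ⋆ h ≈ f ⋆ (g ⋆ h)
⋆-assoc f g h n = begin
  sumTo n (λ i → sumTo i (λ j → f j ℤ.* g (i ∸ j)) ℤ.* h (n ∸ i))
    ≡⟨ sumTo-cong n (λ i _ → sym (sumTo-*ʳ i (h (n ∸ i)) _)) ⟩
  sumTo n (λ i → sumTo i (λ j → f j ℤ.* g (i ∸ j) ℤ.* h (n ∸ i)))
    ≡⟨ sumTo-triangle n _ ⟩
  sumTo n (λ j → sumTo (n ∸ j) (λ l → f j ℤ.* g (j + l ∸ j) ℤ.* h (n ∸ (j + l))))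
    ≡⟨ sumTo-cong n (λ j _ → sumTo-cong (n ∸ j) (λ l _ → reassociate j l)) ⟩
  sumTo n (λ j → sumTo (n ∸ j) (λ l → f j ℤ.* (g l ℤ.* h (n ∸ j ∸ l))))
    ≡⟨ sumTo-cong n (λ j _ → sumTo-*ˡ (n ∸ j) (f j) _) ⟩
  sumTo n (λ j → f j ℤ.* sumTo (n ∸ j) (λ l → g l ℤ.* h (n ∸ j ∸ l))) ∎
  where
  open ≡-Reasoning
  reassociate : ∀ j l → f j ℤ.* g (j + l ∸ j) ℤ.* h (n ∸ (j + l)) ≡ f j ℤ.* (g l ℤ.* h (n ∸ j ∸ l))
  reassociate j l rewrite ℕ.m+n∸m≡n j l | ℕ.∸-+-assoc n j l = ℤ.*-assoc (f j) (g l) _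

⋆-identityˡ : ∀ f → oneS ⋆ f ≈ f
⋆-identityˡ f zero    = ℤ.*-identityˡ (f 0)
⋆-identityˡ f (suc n) = begin
  sumTo (suc n) (λ i → oneS i ℤ.* f (suc n ∸ i))     ≡⟨ sumTo-suc n _ ⟩
  + 1 ℤ.* f (suc n) ℤ.+ sumTo n (λ i → + 0 ℤ.* f (n ∸ i))
    ≡⟨ cong₂ ℤ._+_ (ℤ.*-identityˡ (f (suc n))) (sumTo-zeros n (λ _ _ → refl)) ⟩
  f (suc n) ℤ.+ + 0                                  ≡⟨ ℤ.+-identityʳ _ ⟩
  f (suc n)                                          ∎
  where open ≡-Reasoning

⋆-identityʳ : ∀ f → f ⋆ oneS ≈ f
⋆-identityʳ f = ≈-trans (⋆-comm f oneS) (⋆-identityˡ f)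

⋆-distribˡ : ∀ h f g → h ⋆ (f ⊕ g) ≈ h ⋆ f ⊕ h ⋆ g
⋆-distribˡ h f g n =
  trans (sumTo-cong n (λ i _ → ℤ.*-distribˡ-+ (h i) (f (n ∸ i)) (g (n ∸ i)))) (sumTo-+ n _ _)

⋆-distribʳ : ∀ h f g → (f ⊕ g) ⋆ h ≈ f ⋆ h ⊕ g ⋆ h
⋆-distribʳ h f g n =
  trans (sumTo-cong n (λ i _ → ℤ.*-distribʳ-+ (h (n ∸ i)) (f i) (g i))) (sumTo-+ n _ _)

⋆-swapʳ : ∀ f g h → (f ⋆ g) ⋆ h ≈ (f ⋆ h) ⋆ g
⋆-swapʳ f g h = ≈-trans (⋆-assoc f g h) (≈-trans (⋆-congˡ f (⋆-comm g h)) (≈-sym (⋆-assoc f h g)))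

Σ≤ : ℕ → (ℕ → PS) → PS
Σ≤ A F n = sumTo A (λ a → F a n)

Σ≤-cong : ∀ A {F G : ℕ → PS} → (∀ a → F a ≈ G a) → Σ≤ A F ≈ Σ≤ A G
Σ≤-cong A F≈G n = sumTo-cong A (λ a _ → F≈G a n)

Σ≤-⋆ : ∀ A (F : ℕ → PS) g → Σ≤ A F ⋆ g ≈ Σ≤ A (λ a → F a ⋆ g)
Σ≤-⋆ zero    F g = ≈-refl
Σ≤-⋆ (suc A) F g = ≈-trans (⋆-distribʳ g (Σ≤ A F) (F (suc A))) (⊕-cong (Σ≤-⋆ A F g) ≈-refl)

⋆-Σ≤ : ∀ A (F : ℕ → PS) g → g ⋆ Σ≤ A F ≈ Σ≤ A (λ a → g ⋆ F a)
⋆-Σ≤ A F g = ≈-trans (⋆-comm g (Σ≤ A F))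
  (≈-trans (Σ≤-⋆ A F g) (Σ≤-cong A (λ a → ⋆-comm (F a) g)))

Σ≤-⋆-Σ≤ : ∀ A B (F H : ℕ → PS) → Σ≤ A (λ a → Σ≤ B (λ b → F a ⋆ H b)) ≈ Σ≤ A F ⋆ Σ≤ B H
Σ≤-⋆-Σ≤ A B F H = ≈-trans (Σ≤-cong A (λ a → ≈-sym (⋆-Σ≤ B H (F a)))) (≈-sym (Σ≤-⋆ A F (Σ≤ B H)))

data Offset (x : ℕ) : ℕ → Set where
  below : ∀ {n} → n < x → Offset x n
  above : ∀ d → Offset x (x + d)

offset : ∀ x n → Offset x n
offset zero    n    = above n
offset (suc x) zero = below (s≤s z≤n)
offset (suc x) (suc n) with offset x n
... | below n<x = below (s≤s n<x)
... | above d   = above d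

shift-below : ∀ x f {n} → n < x → shift x f n ≡ + 0
shift-below x f {n} n<x with x ≤ᵇ n | ℕ.≤ᵇ⇒≤ x n
... | true  | x≤n = ⊥-elim (ℕ.<⇒≱ n<x (x≤n _))
... | false | _   = refl

shift-above : ∀ x f d → shift x f (x + d) ≡ f d
shift-above x f d with x ≤ᵇ x + d | ℕ.≤⇒≤ᵇ (ℕ.m≤m+n x d)
... | true | _ = cong f (ℕ.m+n∸m≡n x d)

shift-cong : ∀ x {f g} → f ≈ g → shift x f ≈ shift x g
shift-cong x f≈g n with x ≤ᵇ n
... | true  = f≈g (n ∸ x)
... | false = refl

shift-shift : ∀ x y f → shift x (shift y f) ≈ shift (x + y) f
shift-shift x y f n with offset x n
... | below n<x = trans (shift-below x (shift y f) n<x)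
                        (sym (shift-below (x + y) f (ℕ.<-≤-trans n<x (ℕ.m≤m+n x y))))
... | above d with offset y d
...   | below d<y = trans (shift-above x (shift y f) d) (trans (shift-below y f d<y)
                      (sym (shift-below (x + y) f (ℕ.+-monoʳ-< x d<y))))
...   | above e = trans (shift-above x (shift y f) (y + e)) (trans (shift-above y f e)
                      (sym (trans (cong (shift (x + y) f) (sym (ℕ.+-assoc x y e))) (shift-above (x + y) f e))))

shift-⋆ˡ : ∀ x f g → shift x f ⋆ g ≈ shift x (f ⋆ g)
shift-⋆ˡ x f g n with offset x n
... | below n<x = trans
  (sumTo-zeros n (λ i i≤n → cong (ℤ._* g (n ∸ i)) (shift-below x f (ℕ.≤-<-trans i≤n n<x))))
  (sym (shift-below x (f ⋆ g) n<x))
... | above d = begin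
  sumTo (x + d) (λ i → shift x f i ℤ.* g (x + d ∸ i))
    ≡⟨ sumTo-drop x d _ (λ i i<x → cong (ℤ._* g (x + d ∸ i)) (shift-below x f i<x)) ⟩
  sumTo d (λ i → shift x f (x + i) ℤ.* g (x + d ∸ (x + i)))
    ≡⟨ sumTo-cong d (λ i _ →
         cong₂ ℤ._*_ (shift-above x f i) (cong g (ℕ.[m+n]∸[m+o]≡n∸o x d i))) ⟩
  (f ⋆ g) d
    ≡⟨ shift-above x (f ⋆ g) d ⟨
  shift x (f ⋆ g) (x + d) ∎
  where open ≡-Reasoning

shift-⋆ʳ : ∀ x f g → f ⋆ shift x g ≈ shift x (f ⋆ g)
shift-⋆ʳ x f g = ≈-trans (⋆-comm f (shift x g)) (≈-trans (shift-⋆ˡ x g f) (shift-cong x (⋆-comm g f)))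

shift-⋆-shift : ∀ x y f g → shift x f ⋆ shift y g ≈ shift (x + y) (f ⋆ g)
shift-⋆-shift x y f g = ≈-trans (shift-⋆ˡ x f (shift y g))
  (≈-trans (shift-cong x (shift-⋆ʳ y f g)) (shift-shift x y (f ⋆ g)))

shift-Σ≤ : ∀ x A (F : ℕ → PS) → shift x (Σ≤ A F) ≈ Σ≤ A (λ a → shift x (F a))
shift-Σ≤ x A F n with x ≤ᵇ n
... | true  = refl
... | false = sym (sumTo-zeros A (λ _ _ → refl))

δ : ℕ → ℕ → ℤ
δ n j = if n ≡ᵇ j then + 1 else + 0

δ-≢ : ∀ {n j} → n ≢ j → δ n j ≡ + 0
δ-≢ {n} {j} n≢j with n ≡ᵇ j | ℕ.≡ᵇ⇒≡ n j
... | true  | n≡j = ⊥-elim (n≢j (n≡j _))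
... | false | _   = refl

δ-+ : ∀ p d u → δ (p + d) (p + u) ≡ δ d u
δ-+ zero    d u = refl
δ-+ (suc p) d u = δ-+ p d u

oneMinusQ-+ : ∀ j i → oneMinusQ j ⊕ shift j (oneMinusQ i) ≈ oneMinusQ (j + i)
oneMinusQ-+ j i n with offset j n
... | below n<j = begin
  (δ n 0 ℤ.- δ n j) ℤ.+ shift j (oneMinusQ i) n
    ≡⟨ cong₂ (λ a b → (δ n 0 ℤ.- a) ℤ.+ b) (δ-≢ (ℕ.<⇒≢ n<j)) (shift-below j (oneMinusQ i) n<j) ⟩
  (δ n 0 ℤ.- + 0) ℤ.+ + 0
    ≡⟨ ℤ.+-identityʳ _ ⟩
  δ n 0 ℤ.- + 0
    ≡⟨ cong (λ e → δ n 0 ℤ.- e) (δ-≢ (ℕ.<⇒≢ (ℕ.<-≤-trans n<j (ℕ.m≤m+n j i)))) ⟨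
  δ n 0 ℤ.- δ n (j + i) ∎
  where open ≡-Reasoning
... | above d = begin
  (δ (j + d) 0 ℤ.- δ (j + d) j) ℤ.+ shift j (oneMinusQ i) (j + d)
    ≡⟨ cong₂ (λ a b → (δ (j + d) 0 ℤ.- a) ℤ.+ b)
             (trans (cong (δ (j + d)) (sym (ℕ.+-identityʳ j))) (δ-+ j d 0))
             (shift-above j (oneMinusQ i) d) ⟩
  (δ (j + d) 0 ℤ.- δ d 0) ℤ.+ (δ d 0 ℤ.- δ d i)
    ≡⟨ telescope (δ (j + d) 0) (δ d 0) (δ d i) ⟩
  δ (j + d) 0 ℤ.- δ d i
    ≡⟨ cong (λ e → δ (j + d) 0 ℤ.- e) (δ-+ j d i) ⟨
  δ (j + d) 0 ℤ.- δ (j + d) (j + i) ∎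
  where
  open ≡-Reasoning
  telescope : ∀ a b c → (a ℤ.- b) ℤ.+ (b ℤ.- c) ≡ a ℤ.- c
  telescope = solve-∀

oneMinusQ-pascal : ∀ t m A →
  oneMinusQ (t + t * A) ⊕ shift (t * suc A) (oneMinusQ (t + t * m)) ≈ oneMinusQ (t + t * (m + suc A))
oneMinusQ-pascal t m A rewrite ℕ.*-suc t A = begin
  oneMinusQ (t + t * A) ⊕ shift (t + t * A) (oneMinusQ (t + t * m)) ≈⟨ oneMinusQ-+ (t + t * A) (t + t * m) ⟩
  oneMinusQ (t + t * A + (t + t * m))                                ≡⟨ cong oneMinusQ (degrees t m A) ⟩
  oneMinusQ (t + t * (m + suc A))                                    ∎
  where
  open SetoidReasoning ≈-setoid
  degrees : ∀ t m A → t + t * A + (t + t * m) ≡ t + t * (m + suc A)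
  degrees = ℕ-Solver.solve-∀

foldr-zipWith-downFrom : ∀ (F : ℕ → ℤ → ℤ) (s : ℕ → ℕ) (c : ℕ → ℤ) n →
  foldr ℤ._+_ (+ 0) (zipWith F (applyUpTo s (suc n)) (map c (downFrom (suc n))))
    ≡ sumTo n (λ j → F (s j) (c (n ∸ j)))
foldr-zipWith-downFrom F s c zero    = ℤ.+-identityʳ _
foldr-zipWith-downFrom F s c (suc n) =
  trans (cong (λ e → F (s 0) (c (suc n)) ℤ.+ e) (foldr-zipWith-downFrom F (s ∘ suc) c n))
        (sym (sumTo-suc n (λ j → F (s j) (c (suc n ∸ j)))))

invRev≡map-inv : ∀ f n → invRev f n ≡ map (inv f) (downFrom (suc n))
invRev≡map-inv f zero    = refl
invRev≡map-inv f (suc n) = cong (inv f (suc n) ∷_) (invRev≡map-inv f n)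

inv-suc : ∀ f n → inv f (suc n) ≡ - sumTo n (λ j → f (suc j) ℤ.* inv f (n ∸ j))
inv-suc f n = cong -_ (trans
  (cong (foldr ℤ._+_ (+ 0) ∘ zipWith (λ j c → f (suc j) ℤ.* c) (applyUpTo id (suc n)))
        (invRev≡map-inv f n))
  (foldr-zipWith-downFrom (λ j c → f (suc j) ℤ.* c) id (inv f) n))

⋆-inverseʳ : ∀ f → f 0 ≡ + 1 → f ⋆ inv f ≈ oneS
⋆-inverseʳ f f₀≡1 zero    rewrite f₀≡1 = refl
⋆-inverseʳ f f₀≡1 (suc n) = begin
  sumTo (suc n) (λ i → f i ℤ.* inv f (suc n ∸ i)) ≡⟨ sumTo-suc n _ ⟩
  f 0 ℤ.* inv f (suc n) ℤ.+ S                     ≡⟨ cong₂ (λ a b → a ℤ.* b ℤ.+ S) f₀≡1 (inv-suc f n) ⟩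
  + 1 ℤ.* (- S) ℤ.+ S                             ≡⟨ cancel S ⟩
  + 0                                             ∎
  where
  open ≡-Reasoning
  S = sumTo n (λ j → f (suc j) ℤ.* inv f (n ∸ j))
  cancel : ∀ s → + 1 ℤ.* (- s) ℤ.+ s ≡ + 0
  cancel = solve-∀

⋆-inverseˡ : ∀ f → f 0 ≡ + 1 → inv f ⋆ f ≈ oneS
⋆-inverseˡ f f₀≡1 = ≈-trans (⋆-comm (inv f) f) (⋆-inverseʳ f f₀≡1)

⋆-inv-cancelʳ : ∀ f p → p 0 ≡ + 1 → (f ⋆ p) ⋆ inv p ≈ f
⋆-inv-cancelʳ f p p₀≡1 =
  ≈-trans (⋆-assoc f p (inv p)) (≈-trans (⋆-congˡ f (⋆-inverseʳ p p₀≡1)) (⋆-identityʳ f))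

infix 4 _≈[_]_

_≈[_]_ : PS → ℕ → PS → Set
f ≈[ N ] g = ∀ n → n ≤ N → f n ≡ g n

≈⇒≈[] : ∀ {f g} N → f ≈ g → f ≈[ N ] g
≈⇒≈[] N f≈g n _ = f≈g n

≈[]-refl : ∀ {f N} → f ≈[ N ] f
≈[]-refl _ _ = refl

≈[]-trans : ∀ {f g h N} → f ≈[ N ] g → g ≈[ N ] h → f ≈[ N ] h
≈[]-trans f≈g g≈h n n≤N = trans (f≈g n n≤N) (g≈h n n≤N)

⋆-cong-≈[] : ∀ {f f′ g g′ N} → f ≈[ N ] f′ → g ≈[ N ] g′ → f ⋆ g ≈[ N ] f′ ⋆ g′
⋆-cong-≈[] f≈f′ g≈g′ n n≤N = sumTo-cong n (λ i i≤n →
  cong₂ ℤ._*_ (f≈f′ i (ℕ.≤-trans i≤n n≤N)) (g≈g′ (n ∸ i) (ℕ.≤-trans (ℕ.m∸n≤m n i) n≤N)))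

shift-cong-≈[] : ∀ x {f g N} → f ≈[ N ] g → shift x f ≈[ N ] shift x g
shift-cong-≈[] x f≈g n n≤N with x ≤ᵇ n
... | true  = f≈g (n ∸ x) (ℕ.≤-trans (ℕ.m∸n≤m n x) n≤N)
... | false = refl

oneMinusQ-≈[] : ∀ {N j} → N < j → oneMinusQ j ≈[ N ] oneS
oneMinusQ-≈[] N<j n n≤N =
  trans (cong (λ e → δ n 0 ℤ.- e) (δ-≢ (ℕ.<⇒≢ (ℕ.≤-<-trans n≤N N<j)))) (ℤ.+-identityʳ _)

⋆-cancelʳ-≈[] : ∀ {f g N} p → p 0 ≡ + 1 → f ⋆ p ≈[ N ] g ⋆ p → f ≈[ N ] g
⋆-cancelʳ-≈[] {f} {g} {N} p p₀≡1 fp≈gp =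
  ≈[]-trans (≈⇒≈[] N (≈-sym (⋆-inv-cancelʳ f p p₀≡1)))
  (≈[]-trans (⋆-cong-≈[] fp≈gp (≈[]-refl {inv p}))
             (≈⇒≈[] N (⋆-inv-cancelʳ g p p₀≡1)))

-- Gaussian polynomials

poch-0 : ∀ t m → poch (suc t) m 0 ≡ + 1
poch-0 t zero    = refl
poch-0 t (suc m) = cong (ℤ._* + 1) (poch-0 t m)

poch-≈[] : ∀ t m A → poch (suc t) (m + A) ≈[ A ] poch (suc t) A
poch-≈[] t zero    A = ≈[]-refl
poch-≈[] t (suc m) A =
  ≈[]-trans (⋆-cong-≈[] (≈[]-refl {poch (suc t) (m + A)}) (oneMinusQ-≈[] A<degree))
  (≈[]-trans (≈⇒≈[] A (⋆-identityʳ _)) (poch-≈[] t m A))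
  where
  A<degree : A < suc t + suc t * (m + A)
  A<degree = s≤s (ℕ.≤-trans (ℕ.m≤n+m A m) (ℕ.≤-trans (ℕ.m≤n*m (m + A) (suc t)) (ℕ.m≤n+m _ t)))

-- gaussian t m A is [m+A, m] in the variable q^t: the sum of q^(t Σ aᵢ) over A ≥ a₁ ≥ … ≥ aₘ ≥ 0.
gaussian : ℕ → ℕ → ℕ → PS
gaussian t zero    A = oneS
gaussian t (suc m) A = Σ≤ A (λ a → shift (t * a) (gaussian t m a))

gaussian-0 : ∀ t m → gaussian t m 0 ≈ oneS
gaussian-0 t zero    = ≈-refl
gaussian-0 t (suc m) n = trans (cong (λ x → shift x (gaussian t m 0) n) (ℕ.*-zeroʳ t)) (gaussian-0 t m n)

gaussian-pairs : ∀ t u m A B →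
  Σ≤ A (λ a → Σ≤ B (λ b → shift (t * a + u * b) (gaussian t m a ⋆ gaussian u m b)))
    ≈ gaussian t (suc m) A ⋆ gaussian u (suc m) B
gaussian-pairs t u m A B = ≈-trans
  (Σ≤-cong A λ a → Σ≤-cong B λ b →
    ≈-sym (shift-⋆-shift (t * a) (u * b) (gaussian t m a) (gaussian u m b)))
  (Σ≤-⋆-Σ≤ A B (λ a → shift (t * a) (gaussian t m a)) (λ b → shift (u * b) (gaussian u m b)))

gaussian-⋆-poch : ∀ t m A → (gaussian t m A ⋆ poch t m) ⋆ poch t A ≈ poch t (m + A)
gaussian-⋆-poch t zero    A = ≈-trans (⋆-congʳ (poch t A) (⋆-identityˡ oneS)) (⋆-identityˡ (poch t A))
gaussian-⋆-poch t (suc m) zero = begin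
  (gaussian t (suc m) 0 ⋆ poch t (suc m)) ⋆ oneS ≈⟨ ⋆-identityʳ _ ⟩
  gaussian t (suc m) 0 ⋆ poch t (suc m)          ≈⟨ ⋆-congʳ (poch t (suc m)) (gaussian-0 t (suc m)) ⟩
  oneS ⋆ poch t (suc m)                          ≈⟨ ⋆-identityˡ _ ⟩
  poch t (suc m)                                 ≡⟨ cong (poch t) (ℕ.+-identityʳ (suc m)) ⟨
  poch t (suc m + 0)                             ∎
  where open SetoidReasoning ≈-setoid
gaussian-⋆-poch t (suc m) (suc A) = begin
  ((G₀ ⊕ shift x G₁) ⋆ poch t (suc m)) ⋆ poch t (suc A)
    ≈⟨ ⋆-congʳ (poch t (suc A)) (⋆-distribʳ (poch t (suc m)) G₀ (shift x G₁)) ⟩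
  (G₀ ⋆ poch t (suc m) ⊕ shift x G₁ ⋆ poch t (suc m)) ⋆ poch t (suc A)
    ≈⟨ ⋆-distribʳ (poch t (suc A)) (G₀ ⋆ poch t (suc m)) (shift x G₁ ⋆ poch t (suc m)) ⟩
  (G₀ ⋆ poch t (suc m)) ⋆ poch t (suc A) ⊕ (shift x G₁ ⋆ poch t (suc m)) ⋆ poch t (suc A)
    ≈⟨ ⊕-cong first second ⟩
  P ⋆ oneMinusQ (t + t * A) ⊕ P ⋆ shift x Eₘ
    ≈⟨ ⋆-distribˡ P (oneMinusQ (t + t * A)) (shift x Eₘ) ⟨
  P ⋆ (oneMinusQ (t + t * A) ⊕ shift x Eₘ)
    ≈⟨ ⋆-congˡ P (oneMinusQ-pascal t m A) ⟩
  P ⋆ oneMinusQ (t + t * (m + suc A)) ∎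
  where
  open SetoidReasoning ≈-setoid
  G₀ = gaussian t (suc m) A
  G₁ = gaussian t m (suc A)
  P  = poch t (m + suc A)
  Eₘ = oneMinusQ (t + t * m)
  x  = t * suc A
  first : (G₀ ⋆ poch t (suc m)) ⋆ poch t (suc A) ≈ P ⋆ oneMinusQ (t + t * A)
  first = begin
    (G₀ ⋆ poch t (suc m)) ⋆ (poch t A ⋆ oneMinusQ (t + t * A))
      ≈⟨ ⋆-assoc (G₀ ⋆ poch t (suc m)) (poch t A) (oneMinusQ (t + t * A)) ⟨
    ((G₀ ⋆ poch t (suc m)) ⋆ poch t A) ⋆ oneMinusQ (t + t * A)
      ≈⟨ ⋆-congʳ (oneMinusQ (t + t * A)) (gaussian-⋆-poch t (suc m) A) ⟩
    poch t (suc m + A) ⋆ oneMinusQ (t + t * A)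
      ≡⟨ cong (λ B → poch t B ⋆ oneMinusQ (t + t * A)) (ℕ.+-suc m A) ⟨
    P ⋆ oneMinusQ (t + t * A) ∎
  second : (shift x G₁ ⋆ poch t (suc m)) ⋆ poch t (suc A) ≈ P ⋆ shift x Eₘ
  second = begin
    (shift x G₁ ⋆ (poch t m ⋆ Eₘ)) ⋆ poch t (suc A)
      ≈⟨ ≈-trans (⋆-congʳ (poch t (suc A)) (shift-⋆ˡ x G₁ (poch t (suc m))))
                 (shift-⋆ˡ x (G₁ ⋆ poch t (suc m)) (poch t (suc A))) ⟩
    shift x ((G₁ ⋆ (poch t m ⋆ Eₘ)) ⋆ poch t (suc A))
      ≈⟨ shift-cong x (⋆-congʳ (poch t (suc A)) (⋆-assoc G₁ (poch t m) Eₘ)) ⟨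
    shift x (((G₁ ⋆ poch t m) ⋆ Eₘ) ⋆ poch t (suc A))
      ≈⟨ shift-cong x (⋆-swapʳ (G₁ ⋆ poch t m) Eₘ (poch t (suc A))) ⟩
    shift x (((G₁ ⋆ poch t m) ⋆ poch t (suc A)) ⋆ Eₘ)
      ≈⟨ shift-cong x (⋆-congʳ Eₘ (gaussian-⋆-poch t m (suc A))) ⟩
    shift x (P ⋆ Eₘ)
      ≈⟨ shift-⋆ʳ x P Eₘ ⟨
    P ⋆ shift x Eₘ ∎

gaussian-≈[]-inv-poch : ∀ t m A → gaussian (suc t) m A ≈[ A ] inv (poch (suc t) m)
gaussian-≈[]-inv-poch t m A = ⋆-cancelʳ-≈[] Pₘ (poch-0 t m)
  (≈[]-trans (⋆-cancelʳ-≈[] Pₐ (poch-0 t A) GPP≈[]P)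
             (≈⇒≈[] A (≈-sym (⋆-inverseˡ Pₘ (poch-0 t m)))))
  where
  Pₘ = poch (suc t) m
  Pₐ = poch (suc t) A
  GPP≈[]P : (gaussian (suc t) m A ⋆ Pₘ) ⋆ Pₐ ≈[ A ] oneS ⋆ Pₐ
  GPP≈[]P = ≈[]-trans (≈⇒≈[] A (gaussian-⋆-poch (suc t) m A))
            (≈[]-trans (poch-≈[] t m A) (≈⇒≈[] A (≈-sym (⋆-identityˡ Pₐ))))

qbinom≈gaussian : ∀ m s → qbinom (m + s) s 1 ≈ gaussian 1 m s
qbinom≈gaussian m s n with s ≤ᵇ m + s | ℕ.≤⇒≤ᵇ (ℕ.m≤n+m s m)
... | true | _ rewrite ℕ.m+n∸n≡m m s = begin
  ((poch 1 (m + s) ⋆ inv Pₛ) ⋆ inv Pₘ) n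
    ≡⟨ ⋆-congʳ (inv Pₘ) (⋆-congʳ (inv Pₛ) (gaussian-⋆-poch 1 m s)) n ⟨
  ((((gaussian 1 m s ⋆ Pₘ) ⋆ Pₛ) ⋆ inv Pₛ) ⋆ inv Pₘ) n
    ≡⟨ ⋆-congʳ (inv Pₘ) (⋆-inv-cancelʳ (gaussian 1 m s ⋆ Pₘ) Pₛ (poch-0 0 s)) n ⟩
  ((gaussian 1 m s ⋆ Pₘ) ⋆ inv Pₘ) n
    ≡⟨ ⋆-inv-cancelʳ (gaussian 1 m s) Pₘ (poch-0 0 m) n ⟩
  gaussian 1 m s n ∎
  where
  open ≡-Reasoning
  Pₘ = poch 1 m
  Pₛ = poch 1 s

concat≤ : {X : Set} → ℕ → (ℕ → List X) → List X
concat≤ zero    L = L 0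
concat≤ (suc A) L = concat≤ A L ++ L (suc A)

withHead : ℕ → (ℕ → List (List ℕ)) → ℕ → List (List ℕ)
withHead x L n = if x ≤ᵇ n then map (x ∷_) (L (n ∸ x)) else []

length-concat≤ : ∀ {X : Set} A (L : ℕ → List X) (F : ℕ → PS) n →
  (∀ a → + length (L a) ≡ F a n) → + length (concat≤ A L) ≡ Σ≤ A F n
length-concat≤ zero    L F n ∣L∣≡F = ∣L∣≡F 0
length-concat≤ (suc A) L F n ∣L∣≡F = begin
  + length (concat≤ A L ++ L (suc A))         ≡⟨ cong +_ (List.length-++ (concat≤ A L)) ⟩
  + (length (concat≤ A L) + length (L (suc A))) ≡⟨ ℤ.pos-+ (length (concat≤ A L)) _ ⟩
  + length (concat≤ A L) ℤ.+ + length (L (suc A))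
    ≡⟨ cong₂ ℤ._+_ (length-concat≤ A L F n ∣L∣≡F) (∣L∣≡F (suc A)) ⟩
  Σ≤ (suc A) F n ∎
  where open ≡-Reasoning

length-withHead : ∀ x (L : ℕ → List (List ℕ)) n →
  + length (withHead x L n) ≡ shift x (λ n → + length (L n)) n
length-withHead x L n with x ≤ᵇ n
... | true  = cong +_ (List.length-map (x ∷_) (L (n ∸ x)))
... | false = refl

∈-concat≤⁻ : ∀ {X : Set} A (L : ℕ → List X) {v} → v ∈ concat≤ A L → Σ ℕ λ a → a ≤ A × v ∈ L a
∈-concat≤⁻ zero    L v∈ = 0 , z≤n , v∈
∈-concat≤⁻ (suc A) L v∈ with ∈-++⁻ (concat≤ A L) v∈
... | inj₁ v∈L≤A = let a , a≤A , v∈La = ∈-concat≤⁻ A L v∈L≤A in a , ℕ.m≤n⇒m≤1+n a≤A , v∈La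
... | inj₂ v∈LA  = suc A , ℕ.≤-refl , v∈LA

∈-concat≤⁺ : ∀ {X : Set} A (L : ℕ → List X) {v a} → a ≤ A → v ∈ L a → v ∈ concat≤ A L
∈-concat≤⁺ zero    L z≤n v∈ = v∈
∈-concat≤⁺ (suc A) L a≤1+A v∈ with ℕ.m≤n⇒m<n∨m≡n a≤1+A
... | inj₁ a<1+A = ∈-++⁺ˡ (∈-concat≤⁺ A L (ℕ.≤-pred a<1+A) v∈)
... | inj₂ refl  = ∈-++⁺ʳ (concat≤ A L) v∈

concat≤-unique : ∀ {X : Set} A (L : ℕ → List X) →
  (∀ a → a ≤ A → Unique (L a)) → (∀ {a a′} → a < a′ → a′ ≤ A → Disjoint (L a) (L a′)) →
  Unique (concat≤ A L)
concat≤-unique zero    L unique disjoint = unique 0 z≤n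
concat≤-unique (suc A) L unique disjoint = Unique.++⁺
  (concat≤-unique A L (λ a a≤A → unique a (ℕ.m≤n⇒m≤1+n a≤A))
                      (λ a<a′ a′≤A → disjoint a<a′ (ℕ.m≤n⇒m≤1+n a′≤A)))
  (unique (suc A) ℕ.≤-refl)
  (λ (v∈L≤A , v∈LA) → let a , a≤A , v∈La = ∈-concat≤⁻ A L v∈L≤A
                      in disjoint (s≤s a≤A) ℕ.≤-refl (v∈La , v∈LA))

∈-withHead⁻ : ∀ x L n {π} → π ∈ withHead x L n → Σ (List ℕ) λ ρ → π ≡ x ∷ ρ × ρ ∈ L (n ∸ x) × x ≤ n
∈-withHead⁻ x L n π∈ with x ≤ᵇ n | ℕ.≤ᵇ⇒≤ x n
... | true | x≤n = let ρ , ρ∈ , π≡x∷ρ = ∈-map⁻ (x ∷_) π∈ in ρ , π≡x∷ρ , ρ∈ , x≤n _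

∈-withHead⁺ : ∀ x L n {ρ} → x ≤ n → ρ ∈ L (n ∸ x) → x ∷ ρ ∈ withHead x L n
∈-withHead⁺ x L n x≤n ρ∈ with x ≤ᵇ n | ℕ.≤⇒≤ᵇ x≤n
... | true | _ = ∈-map⁺ (x ∷_) ρ∈

withHead-unique : ∀ x L n → Unique (L (n ∸ x)) → Unique (withHead x L n)
withHead-unique x L n unique with x ≤ᵇ n
... | true  = Unique.map⁺ List.∷-injectiveʳ unique
... | false = []

linked-∷-sum : ∀ {x} {π : List ℕ} → Linked _≥_ π → sum π ≤ x → Linked _≥_ (x ∷ π)
linked-∷-sum {π = []}     _  _       = [-]
linked-∷-sum {π = y ∷ ys} lk Σπ≤x = ℕ.≤-trans (ℕ.m≤m+n y (sum ys)) Σπ≤x ∷ lk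

-- Partitions in P_{k,r}

module Enumeration (k : ℕ) where

  -- The part φ + k a with φ = suc b: indexing by b lets Σ≤ and concat≤, which start at 0,
  -- range over both coordinates.
  part : ℕ → ℕ → ℕ
  part a b = suc b + k * a

  partitions : ℕ → ℕ → ℕ → ℕ → List (List ℕ)
  partitions zero    A B n = if n ≡ᵇ 0 then [] ∷ [] else []
  partitions (suc m) A B n = concat≤ A λ a → concat≤ B λ b → withHead (part a b) (partitions m a b) n

  data Decomposed : ℕ → ℕ → List ℕ → Set where
    []   : ∀ {A B} → Decomposed A B []
    cons : ∀ {A B a b π} → a ≤ A → b ≤ B → Decomposed a b π → Decomposed A B (part a b ∷ π)

  part-mono : ∀ {a b A B} → a ≤ A → b ≤ B → part a b ≤ part A B
  part-mono a≤A b≤B = ℕ.+-mono-≤ (s≤s b≤B) (ℕ.*-monoʳ-≤ k a≤A)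

  part-≤⇒≤ : ∀ {a b A B} → B < k → part a b ≤ part A B → a ≤ A
  part-≤⇒≤ {a} {b} {A} {B} B<k ab≤AB = ℕ.≮⇒≥ (λ A<a → ℕ.<⇒≱ (AB<ab A<a) ab≤AB)
    where
    AB<ab : A < a → part A B < part a b
    AB<ab A<a = begin-strict
      suc B + k * A ≤⟨ ℕ.+-monoˡ-≤ (k * A) B<k ⟩
      k + k * A     ≡⟨ ℕ.*-suc k A ⟨
      k * suc A     ≤⟨ ℕ.*-monoʳ-≤ k A<a ⟩
      k * a         <⟨ ℕ.m<n+m (k * a) (s≤s z≤n) ⟩
      suc b + k * a ∎
      where open ℕ.≤-Reasoning

  part-injective : ∀ {a b a′ b′} → b < k → b′ < k → part a b ≡ part a′ b′ → a ≡ a′ × b ≡ b′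
  part-injective {a} {b} {a′} {b′} b<k b′<k ab≡a′b′ = a≡a′ , b≡b′
    where
    a≡a′ : a ≡ a′
    a≡a′ = ℕ.≤-antisym (part-≤⇒≤ b′<k (ℕ.≤-reflexive ab≡a′b′))
                       (part-≤⇒≤ b<k (ℕ.≤-reflexive (sym ab≡a′b′)))
    b≡b′ : b ≡ b′
    b≡b′ = ℕ.suc-injective (ℕ.+-cancelʳ-≡ (k * a) (suc b) (suc b′)
             (trans ab≡a′b′ (cong (λ c → suc b′ + k * c) (sym a≡a′))))

  part-≡-mod : ∀ a b → (+ k) ∣ℤ (+ part a b ℤ.- + suc b)
  part-≡-mod a b = divides a (begin
    ℤ.∣ + part a b ℤ.- + suc b ∣ ≡⟨ cong ℤ.∣_∣ (ℤ.m-n≡m⊖n (part a b) (suc b)) ⟩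
    ℤ.∣ part a b ℤ.⊖ suc b ∣      ≡⟨ cong ℤ.∣_∣ (ℤ.⊖-≥ (ℕ.m≤m+n (suc b) (k * a))) ⟩
    part a b ∸ suc b              ≡⟨ ℕ.m+n∸m≡n (suc b) (k * a) ⟩
    k * a                         ≡⟨ ℕ.*-comm k a ⟩
    a * k                         ∎)
    where open ≡-Reasoning

  ≡-mod⇒part : ∀ {x b} → 1 ≤ x → b < k → (+ k) ∣ℤ (+ x ℤ.- + suc b) → Σ ℕ λ a → x ≡ part a b
  ≡-mod⇒part {x} {b} 1≤x b<k (divides a ∣x-v∣≡ak) with suc b ℕ.≤? x
  ... | yes v≤x = a , (begin
    x                           ≡⟨ ℕ.m+[n∸m]≡n v≤x ⟨
    suc b + (x ∸ suc b)         ≡⟨ cong (λ i → suc b + ℤ.∣ i ∣) (trans (ℤ.m-n≡m⊖n x (suc b)) (ℤ.⊖-≥ v≤x)) ⟨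
    suc b + ℤ.∣ + x ℤ.- + suc b ∣ ≡⟨ cong (λ i → suc b + i) ∣x-v∣≡ak ⟩
    suc b + a * k               ≡⟨ cong (λ i → suc b + i) (ℕ.*-comm a k) ⟩
    part a b                    ∎)
    where open ≡-Reasoning
  ... | no v≰x = ⊥-elim (>⇒∤ {{ℕ.>-nonZero (ℕ.m<n⇒0<n∸m x<v)}} v-x<k (divides a (trans v∸x≡∣x-v∣ ∣x-v∣≡ak)))
    where
    x<v = ℕ.≰⇒> v≰x
    v∸x≡∣x-v∣ : suc b ∸ x ≡ ℤ.∣ + x ℤ.- + suc b ∣
    v∸x≡∣x-v∣ = sym (trans (cong ℤ.∣_∣ (ℤ.m-n≡m⊖n x (suc b))) (ℤ.∣⊖∣-< x<v))
    v-x<k : suc b ∸ x < k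
    v-x<k = ℕ.<-≤-trans (ℕ.∸-monoʳ-< 1≤x (ℕ.<⇒≤ x<v)) b<k

  decomposed-positive : ∀ {A B π} → Decomposed A B π → All (1 ≤_) π
  decomposed-positive []           = []
  decomposed-positive (cons _ _ d) = s≤s z≤n ∷ decomposed-positive d

  decomposed-linked : ∀ {A B π} → Decomposed A B π → Linked _≥_ (part A B ∷ π)
  decomposed-linked []               = [-]
  decomposed-linked (cons a≤A b≤B d) = part-mono a≤A b≤B ∷ decomposed-linked d

  decomposed-phis : ∀ {r A B π} → B < r → Decomposed A B π →
    Σ (List ℕ) λ φs → Pointwise (HasPhi k r) π φs × Linked _≥_ (suc B ∷ φs)
  decomposed-phis B<r [] = [] , [] , [-]
  decomposed-phis B<r (cons {a = a} {b} a≤A b≤B d) =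
    let φs , φs-ok , φs-linked = decomposed-phis (ℕ.≤-<-trans b≤B B<r) d
    in suc b ∷ φs , (s≤s z≤n , ℕ.≤-<-trans b≤B B<r , part-≡-mod a b) ∷ φs-ok , s≤s b≤B ∷ φs-linked

  linked⇒decomposed : ∀ {r A B π φs} → B < k → r ≤ k → All (1 ≤_) π → Pointwise (HasPhi k r) π φs →
    Linked _≥_ (part A B ∷ π) → Linked _≥_ (suc B ∷ φs) → Decomposed A B π
  linked⇒decomposed B<k r≤k [] [] _ _ = []
  linked⇒decomposed B<k r≤k (1≤x ∷ pos) ((s≤s z≤n , v≤r , k∣x-v) ∷ φs-ok)
                    (x≤AB ∷ π-linked) (v≤1+B ∷ φs-linked)
    with ≡-mod⇒part 1≤x (ℕ.≤-trans v≤r r≤k) k∣x-v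
  ... | a , refl = cons (part-≤⇒≤ B<k x≤AB) (ℕ.≤-pred v≤1+B)
                        (linked⇒decomposed (ℕ.≤-trans v≤r r≤k) r≤k pos φs-ok π-linked φs-linked)

  ∈-partitions⁻ : ∀ m A B n {π} → π ∈ partitions m A B n → Decomposed A B π × length π ≡ m × sum π ≡ n
  ∈-partitions⁻ zero A B n π∈ with n ≡ᵇ 0 | ℕ.≡ᵇ⇒≡ n 0
  ∈-partitions⁻ zero A B n (here refl) | true | n≡0 = [] , refl , sym (n≡0 _)
  ∈-partitions⁻ zero A B n (there ())  | true | _
  ∈-partitions⁻ (suc m) A B n π∈ with ∈-concat≤⁻ A _ π∈
  ... | a , a≤A , π∈a with ∈-concat≤⁻ B _ π∈a
  ... | b , b≤B , π∈ab with ∈-withHead⁻ (part a b) (partitions m a b) n π∈ab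
  ... | ρ , refl , ρ∈ , x≤n =
    let d , ∣ρ∣≡m , Σρ≡n-x = ∈-partitions⁻ m a b (n ∸ part a b) ρ∈
    in cons a≤A b≤B d , cong suc ∣ρ∣≡m , trans (cong (λ i → part a b + i) Σρ≡n-x) (ℕ.m+[n∸m]≡n x≤n)

  ∈-partitions⁺ : ∀ {A B π} → Decomposed A B π → π ∈ partitions (length π) A B (sum π)
  ∈-partitions⁺ [] = here refl
  ∈-partitions⁺ {A} {B} (cons {a = a} {b} {ρ} a≤A b≤B d) =
    ∈-concat≤⁺ A _ a≤A (∈-concat≤⁺ B _ b≤B (∈-withHead⁺ (part a b) (partitions (length ρ) a b) n
      (ℕ.m≤m+n (part a b) (sum ρ))
      (subst (λ i → ρ ∈ partitions (length ρ) a b i) (sym (ℕ.m+n∸m≡n (part a b) (sum ρ)))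
             (∈-partitions⁺ d))))
    where n = part a b + sum ρ

  partitions-unique : ∀ m A B n → B < k → Unique (partitions m A B n)
  partitions-unique zero A B n B<k with n ≡ᵇ 0
  ... | true  = [] ∷ []
  ... | false = []
  partitions-unique (suc m) A B n B<k =
    concat≤-unique A row (λ a _ → concat≤-unique B (block a) (λ b → block-unique a) (blocks-disjoint a))
                   rows-disjoint
    where
    block : ℕ → ℕ → List (List ℕ)
    block a b = withHead (part a b) (partitions m a b) n
    row : ℕ → List (List ℕ)
    row a = concat≤ B (block a)
    b<k : ∀ {b} → b ≤ B → b < k
    b<k b≤B = ℕ.≤-<-trans b≤B B<k
    block-unique : ∀ a {b} → b ≤ B → Unique (block a b)
    block-unique a {b} b≤B = withHead-unique (part a b) (partitions m a b) n (partitions-unique m a b _ (b<k b≤B))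
    same-block : ∀ {a b a′ b′ π} → b ≤ B → b′ ≤ B → π ∈ block a b → π ∈ block a′ b′ → a ≡ a′ × b ≡ b′
    same-block {a} {b} {a′} {b′} b≤B b′≤B π∈ π∈′
      with ∈-withHead⁻ (part a b) (partitions m a b) n π∈ | ∈-withHead⁻ (part a′ b′) (partitions m a′ b′) n π∈′
    ... | _ , refl , _ | _ , π≡ , _ = part-injective (b<k b≤B) (b<k b′≤B) (List.∷-injectiveˡ π≡)
    blocks-disjoint : ∀ a {b b′} → b < b′ → b′ ≤ B → Disjoint (block a b) (block a b′)
    blocks-disjoint a b<b′ b′≤B (π∈ , π∈′) =
      ℕ.<⇒≢ b<b′ (proj₂ (same-block (ℕ.<⇒≤ (ℕ.<-≤-trans b<b′ b′≤B)) b′≤B π∈ π∈′))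
    rows-disjoint : ∀ {a a′} → a < a′ → a′ ≤ A → Disjoint (row a) (row a′)
    rows-disjoint {a} {a′} a<a′ _ (π∈ , π∈′) =
      let _ , b≤B , π∈b = ∈-concat≤⁻ B (block a) π∈ ; _ , b′≤B , π∈b′ = ∈-concat≤⁻ B (block a′) π∈′
      in ℕ.<⇒≢ a<a′ (proj₁ (same-block b≤B b′≤B π∈b π∈b′))

  length-partitions : ∀ m A B →
    (λ n → + length (partitions m A B n)) ≈ shift m (gaussian k m A ⋆ gaussian 1 m B)
  length-partitions zero A B n = trans length-base (sym (⋆-identityˡ oneS n))
    where
    length-base : + length (partitions zero A B n) ≡ oneS n
    length-base with n ≡ᵇ 0
    ... | true  = refl
    ... | false = refl
  length-partitions (suc m) A B = begin
    (λ n → + length (partitions (suc m) A B n))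
      ≈⟨ (λ n → length-concat≤ A _ (λ a → Σ≤ B λ b → shift (part a b) (∣partitions∣ a b)) n λ a →
                  length-concat≤ B _ (λ b → shift (part a b) (∣partitions∣ a b)) n λ b →
                  length-withHead (part a b) (partitions m a b) n) ⟩
    Σ≤ A (λ a → Σ≤ B λ b → shift (part a b) (∣partitions∣ a b))
      ≈⟨ Σ≤-cong A (λ a → Σ≤-cong B λ b → shift-cong (part a b) (length-partitions m a b)) ⟩
    Σ≤ A (λ a → Σ≤ B λ b → shift (part a b) (shift m (G a b)))
      ≈⟨ Σ≤-cong A (λ a → Σ≤-cong B λ b → ≈-trans (shift-shift (part a b) m (G a b))
           (≈-trans (λ n → cong (λ x → shift x (G a b) n) (exponents a b))
                    (≈-sym (shift-shift (suc m) (k * a + 1 * b) (G a b))))) ⟩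
    Σ≤ A (λ a → Σ≤ B λ b → shift (suc m) (shift (k * a + 1 * b) (G a b)))
      ≈⟨ Σ≤-cong A (λ a → shift-Σ≤ (suc m) B λ b → shift (k * a + 1 * b) (G a b)) ⟨
    Σ≤ A (λ a → shift (suc m) (Σ≤ B λ b → shift (k * a + 1 * b) (G a b)))
      ≈⟨ shift-Σ≤ (suc m) A (λ a → Σ≤ B λ b → shift (k * a + 1 * b) (G a b)) ⟨
    shift (suc m) (Σ≤ A λ a → Σ≤ B λ b → shift (k * a + 1 * b) (G a b))
      ≈⟨ shift-cong (suc m) (gaussian-pairs k 1 m A B) ⟩
    shift (suc m) (gaussian k (suc m) A ⋆ gaussian 1 (suc m) B) ∎
    where
    open SetoidReasoning ≈-setoid
    ∣partitions∣ : ℕ → ℕ → PS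
    ∣partitions∣ a b n = + length (partitions m a b n)
    G : ℕ → ℕ → PS
    G a b = gaussian k m a ⋆ gaussian 1 m b
    exponents : ∀ a b → part a b + m ≡ suc m + (k * a + 1 * b)
    exponents a b = lemma (k * a) b m
      where
      lemma : ∀ c b m → suc b + c + m ≡ suc m + (c + 1 * b)
      lemma = ℕ-Solver.solve-∀

  partitions-sound : ∀ {s m n π} → π ∈ partitions m n s n →
    IsPartition π × InP k (suc s) π × length π ≡ m × sum π ≡ n
  partitions-sound {m = m} {n} π∈ =
    let d , ∣π∣≡m , Σπ≡n = ∈-partitions⁻ m n _ n π∈
        φs , φs-ok , φs-linked = decomposed-phis ℕ.≤-refl d
    in (decomposed-positive d , Linked.tail (decomposed-linked d)) ,
       (φs , φs-ok , Linked.tail φs-linked) , ∣π∣≡m , Σπ≡n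

  partitions-complete : ∀ {s π} → s < k → IsPartition π → InP k (suc s) π →
    π ∈ partitions (length π) (sum π) s (sum π)
  partitions-complete {s} {π} s<k (pos , π-linked) (φs , φs-ok , φs-linked) = ∈-partitions⁺
    (linked⇒decomposed s<k s<k pos φs-ok (linked-∷-sum π-linked Σπ≤part) (phis-bounded φs-ok φs-linked))
    where
    Σπ≤part : sum π ≤ part (sum π) s
    Σπ≤part = ℕ.≤-trans (ℕ.m≤n*m (sum π) k {{ℕ.>-nonZero (ℕ.≤-<-trans z≤n s<k)}})
                        (ℕ.m≤n+m (k * sum π) (suc s))
    phis-bounded : ∀ {ρ φs} → Pointwise (HasPhi k (suc s)) ρ φs → Linked _≥_ φs → Linked _≥_ (suc s ∷ φs)
    phis-bounded []                 _  = [-]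
    phis-bounded ((_ , v≤r , _) ∷ _) lk = v≤r ∷ lk

  partitions-spec : ∀ {s} → s < k → ∀ m n π →
    π ∈ partitions m n s n ⇔ (IsPartition π × InP k (suc s) π × length π ≡ m × sum π ≡ n)
  partitions-spec {s} s<k m n π = mk⇔ partitions-sound λ (isP , inP , ∣π∣≡m , Σπ≡n) →
    subst₂ (λ m n → π ∈ partitions m n s n) ∣π∣≡m Σπ≡n (partitions-complete s<k isP inP)

partitions-count : ∀ t s m n →
  + length (Enumeration.partitions (suc t) m n s n) ≡ rhsCoeff (suc t) (suc s) m n
partitions-count t s m n = begin
  + length (partitions m n s n)
    ≡⟨ length-partitions m n s n ⟩
  shift m (gaussian k m n ⋆ gaussian 1 m s) n
    ≡⟨ shift-cong-≈[] m (⋆-cong-≈[] (gaussian-≈[]-inv-poch t m n) (≈[]-refl {gaussian 1 m s})) n ℕ.≤-refl ⟩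
  shift m (inv (poch k m) ⋆ gaussian 1 m s) n
    ≡⟨ shift-cong m (⋆-congˡ (inv (poch k m)) (qbinom≈gaussian m s)) n ⟨
  shift m (inv (poch k m) ⋆ qbinom (m + s) s 1) n
    ≡⟨ cong (λ i → shift m (inv (poch k m) ⋆ qbinom (i ∸ 1) s 1) n) (ℕ.+-suc m s) ⟨
  rhsCoeff k (suc s) m n ∎
  where
  k = suc t
  open Enumeration k
  open ≡-Reasoning

mainTheorem1 : (k r : ℕ) → 1 ≤ r → r ≤ k → (m n : ℕ) →
    Σ (List (List ℕ)) (λ L →
      Unique L ×
      ((π : List ℕ) → (π ∈ L) ⇔ (IsPartition π × InP k r π × length π ≡ m × sum π ≡ n)) ×
      (+ length L ≡ rhsCoeff k r m n))
mainTheorem1 _       zero    ()  _   _ _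
mainTheorem1 zero    (suc _) _   ()  _ _
mainTheorem1 (suc t) (suc s) _   r≤k m n =
  partitions m n s n , partitions-unique m n s n r≤k , partitions-spec r≤k m n , partitions-count t s m n
  where open Enumeration (suc t)
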